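{- For every MAV structure $P$: if $P\longrightarrow^*\mathbf 1$ in MAV, then for every MAV-frame $F$ and every valuation $V$ of atoms in $\mathrm{Chu}(F)$, $I\sqsubseteq[\![P]\!]$ in $\mathrm{Chu}(F)$.
   Context: MAV syntax: structures $P ::= a \mid a^\perp \mid \mathbf{1} \mid P;Q \mid P\otimes Q \mid P⅋Q \mid P\& Q \mid P\oplus Q$ over a set of atoms, modulo the congruence making $(;,\mathbf 1)$ a monoid and $(\otimes,\mathbf 1),(⅋,\mathbf 1)$ commutative monoids; duality $(a)^\perp=a^\perp$, $(a^\perp)^\perp=a$, $\mathbf 1^\perp=\mathbf 1$, $(P\otimes Q)^\perp=P^\perp⅋Q^\perp$, $(P⅋Q)^\perp=P^\perp\otimes Q^\perp$, $(P;Q)^\perp=P^\perp;Q^\perp$, $(P\&Q)^\perp=P^\perp\oplus Q^\perp$, $(P\oplus Q)^\perp=P^\perp\&Q^\perp$. $P\longrightarrow Q$ is the least relation closed under one-hole contexts ($P\to Q$ implies $C[P]\to C[Q]$) containing: $P⅋P^\perp\to\mathbf 1$; $(P\otimes Q)⅋R\to P\otimes(Q⅋R)$; $\mathbf 1\&\mathbf 1\to\mathbf 1$; $(P;Q)⅋(R;S)\to(P⅋R);(Q⅋S)$; $P\oplus Q\to P$; $P\oplus Q\to Q$; $(P\&Q)⅋R\to(P⅋R)\&(Q⅋R)$; $(P;Q)\&(R;S)\to(P\&R);(Q\&S)$; $\mathbf 1\to P\otimes P^\perp$; $\mathbf 1\to\mathbf 1\oplus\mathbf 1$; $(P\otimes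 R);(Q\otimes S)\to(P;Q)\otimes(R;S)$; $P\to P\&Q$; $Q\to P\&Q$; $(P\otimes R)\oplus(Q\otimes R)\to(P\oplus Q)\otimes R$; $(P\oplus R);(Q\oplus S)\to(P;Q)\oplus(R;S)$. $\longrightarrow^*$ is its reflexive–transitive closure. An MAV-frame is $(F,\le,⅋,\lhd,i,+)$: poset, commutative pomonoid $(⅋,i)$, pomonoid $(\lhd,i)$ (operations monotone), monotone binary $+$, with $(w\lhd x)⅋(y\lhd z)\le(w⅋y)\lhd(x⅋z)$, $(x+y)⅋z\le(x⅋z)+(y⅋z)$, $(w\lhd x)+(y\lhd z)\le(w+y)\lhd(x+z)$, $i+i\le i$. $\mathrm{Chu}(F)$: with $\eta(x)=\{y\mid y\le x\}$, $\alpha(X)=\{x\mid x\le$ some finite $+$-combination of elements of $X\}$, $\mathcal C(F)$ the $+$-closed down-closed subsets, $X\vee Y=\alpha(X\cup Y)$, $K=\eta(i)$, $X\circledast Y=\alpha(\{z\mid z\le x⅋y,x\in X,y\in Y\})$, $X\hat\lhd Y=\{z\mid z\le x\lhd y,x\in X,y\in Y\}$, $X\multimap Y=\{z\mid\forall x\in X,\ z⅋x\in Y\}$; elements are pairs $(X^+,X^-)\in\mathcal C(F)^2$ with $X^+\circledast X^-\subseteq K$, ordered by $X\sqsubseteq Y$ iff $X^+\subseteq Y^+$ and $Y^-\subseteq X^-$; $X\otimes Y=(X^+\circledast Y^+,(Y^+\multimap X^-)\cap(X^+\multimap Y^-))$, $I=(K,K)$, $\neg(X^+,X^-)=(X^-,X^+)$,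 $X\lhd Y=(X^+\hat\lhd Y^+,X^-\hat\lhd Y^-)$, $X\&Y=(X^+\cap Y^+,X^-\vee Y^-)$. Interpretation given valuation $V$: $[\![\mathbf 1]\!]=I$, $[\![a]\!]=V(a)$, $[\![a^\perp]\!]=\neg V(a)$, $[\![P\otimes Q]\!]=[\![P]\!]\otimes[\![Q]\!]$, $[\![P⅋Q]\!]=\neg(\neg[\![P]\!]\otimes\neg[\![Q]\!])$, $[\![P;Q]\!]=[\![P]\!]\lhd[\![Q]\!]$, $[\![P\&Q]\!]=[\![P]\!]\&[\![Q]\!]$, $[\![P\oplus Q]\!]=\neg(\neg[\![P]\!]\&\neg[\![Q]\!])$. -}

module Defs where

open import Level using (0ℓ)
open import Data.Product using (Σ; _×_; _,_; ∃)
open import Data.Sum using (_⊎_)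
open import Relation.Binary.PropositionalEquality using (_≡_)
open import Relation.Unary using (Pred; _⊆_)

infixr 6 _⨾_
infixr 7 _⊗_ _⅋_ _&_ _⊕_

data Str (A : Set) : Set where
  atom  : A → Str A
  natom : A → Str A
  𝟏     : Str A
  _⨾_   : Str A → Str A → Str A
  _⊗_   : Str A → Str A → Str A
  _⅋_   : Str A → Str A → Str A
  _&_   : Str A → Str A → Str A
  _⊕_   : Str A → Str A → Str A

module _ {A : Set} where

  _⊥ : Str A → Str A
  atom a ⊥  = natom a
  natom a ⊥ = atom a
  𝟏 ⊥       = 𝟏
  (P ⨾ Q) ⊥ = (P ⊥) ⨾ (Q ⊥)
  (P ⊗ Q) ⊥ = (P ⊥) ⅋ (Q ⊥)
  (P ⅋ Q) ⊥ = (P ⊥) ⊗ (Q ⊥)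
  (P & Q) ⊥ = (P ⊥) ⊕ (Q ⊥)
  (P ⊕ Q) ⊥ = (P ⊥) & (Q ⊥)

  infix 4 _≈_
  data _≈_ : Str A → Str A → Set where
    ≈-refl  : ∀ {P} → P ≈ P
    ≈-sym   : ∀ {P Q} → P ≈ Q → Q ≈ P
    ≈-trans : ∀ {P Q R} → P ≈ Q → Q ≈ R → P ≈ R
    s⨾-cong : ∀ {P P' Q Q'} → P ≈ P' → Q ≈ Q' → (P ⨾ Q) ≈ (P' ⨾ Q')
    s⊗-cong : ∀ {P P' Q Q'} → P ≈ P' → Q ≈ Q' → (P ⊗ Q) ≈ (P' ⊗ Q')
    s⅋-cong : ∀ {P P' Q Q'} → P ≈ P' → Q ≈ Q' → (P ⅋ Q) ≈ (P' ⅋ Q')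
    s&-cong : ∀ {P P' Q Q'} → P ≈ P' → Q ≈ Q' → (P & Q) ≈ (P' & Q')
    s⊕-cong : ∀ {P P' Q Q'} → P ≈ P' → Q ≈ Q' → (P ⊕ Q) ≈ (P' ⊕ Q')
    s⨾-assoc : ∀ {P Q R} → ((P ⨾ Q) ⨾ R) ≈ (P ⨾ (Q ⨾ R))
    s⨾-idˡ   : ∀ {P} → (𝟏 ⨾ P) ≈ P
    s⨾-idʳ   : ∀ {P} → (P ⨾ 𝟏) ≈ P
    s⊗-assoc : ∀ {P Q R} → ((P ⊗ Q) ⊗ R) ≈ (P ⊗ (Q ⊗ R))
    s⊗-comm  : ∀ {P Q} → (P ⊗ Q) ≈ (Q ⊗ P)
    s⊗-idʳ   : ∀ {P} → (P ⊗ 𝟏) ≈ P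
    s⅋-assoc : ∀ {P Q R} → ((P ⅋ Q) ⅋ R) ≈ (P ⅋ (Q ⅋ R))
    s⅋-comm  : ∀ {P Q} → (P ⅋ Q) ≈ (Q ⅋ P)
    s⅋-idʳ   : ∀ {P} → (P ⅋ 𝟏) ≈ P

  data Rule : Str A → Str A → Set where
    r-ax      : ∀ {P} → Rule (P ⅋ (P ⊥)) 𝟏
    r-switch  : ∀ {P Q R} → Rule ((P ⊗ Q) ⅋ R) (P ⊗ (Q ⅋ R))
    r-tidy    : Rule (𝟏 & 𝟏) 𝟏
    r-seq     : ∀ {P Q R S} → Rule ((P ⨾ Q) ⅋ (R ⨾ S)) ((P ⅋ R) ⨾ (Q ⅋ S))
    r-left    : ∀ {P Q} → Rule (P ⊕ Q) P
    r-right   : ∀ {P Q} → Rule (P ⊕ Q) Q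
    r-ext     : ∀ {P Q R} → Rule ((P & Q) ⅋ R) ((P ⅋ R) & (Q ⅋ R))
    r-medial  : ∀ {P Q R S} → Rule ((P ⨾ Q) & (R ⨾ S)) ((P & R) ⨾ (Q & S))
    r-coax    : ∀ {P} → Rule 𝟏 (P ⊗ (P ⊥))
    r-cotidy  : Rule 𝟏 (𝟏 ⊕ 𝟏)
    r-coseq   : ∀ {P Q R S} → Rule ((P ⊗ R) ⨾ (Q ⊗ S)) ((P ⨾ Q) ⊗ (R ⨾ S))
    r-coleft  : ∀ {P Q} → Rule P (P & Q)
    r-coright : ∀ {P Q} → Rule Q (P & Q)
    r-coext   : ∀ {P Q R} → Rule ((P ⊗ R) ⊕ (Q ⊗ R)) ((P ⊕ Q) ⊗ R)
    r-comedial : ∀ {P Q R S} → Rule ((P ⊕ R) ⨾ (Q ⊕ S)) ((P ⨾ Q) ⊕ (R ⨾ S))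

  data _↝_ : Str A → Str A → Set where
    root : ∀ {P Q} → Rule P Q → P ↝ Q
    ⨾ˡ : ∀ {P Q R} → P ↝ Q → (P ⨾ R) ↝ (Q ⨾ R)
    ⨾ʳ : ∀ {P Q R} → P ↝ Q → (R ⨾ P) ↝ (R ⨾ Q)
    ⊗ˡ : ∀ {P Q R} → P ↝ Q → (P ⊗ R) ↝ (Q ⊗ R)
    ⊗ʳ : ∀ {P Q R} → P ↝ Q → (R ⊗ P) ↝ (R ⊗ Q)
    ⅋ˡ : ∀ {P Q R} → P ↝ Q → (P ⅋ R) ↝ (Q ⅋ R)
    ⅋ʳ : ∀ {P Q R} → P ↝ Q → (R ⅋ P) ↝ (R ⅋ Q)
    &ˡ : ∀ {P Q R} → P ↝ Q → (P & R) ↝ (Q & R)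
    &ʳ : ∀ {P Q R} → P ↝ Q → (R & P) ↝ (R & Q)
    ⊕ˡ : ∀ {P Q R} → P ↝ Q → (P ⊕ R) ↝ (Q ⊕ R)
    ⊕ʳ : ∀ {P Q R} → P ↝ Q → (R ⊕ P) ↝ (R ⊕ Q)

  infix 4 _⟶_ _⟶*_
  _⟶_ : Str A → Str A → Set
  P ⟶ Q = Σ (Str A) λ P' → Σ (Str A) λ Q' → P ≈ P' × P' ↝ Q' × Q' ≈ Q

  data _⟶*_ : Str A → Str A → Set where
    done : ∀ {P Q} → P ≈ Q → P ⟶* Q
    step : ∀ {P Q R} → P ⟶ Q → Q ⟶* R → P ⟶* R

record MAVFrame : Set₁ where
  infix 4 _≤_
  infixr 7 _⅋ᶠ_ _◁_ _+_
  field
    Carrier : Set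
    _≤_     : Carrier → Carrier → Set
    ≤-refl    : ∀ {x} → x ≤ x
    ≤-trans   : ∀ {x y z} → x ≤ y → y ≤ z → x ≤ z
    ≤-antisym : ∀ {x y} → x ≤ y → y ≤ x → x ≡ y
    _⅋ᶠ_ : Carrier → Carrier → Carrier
    _◁_ : Carrier → Carrier → Carrier
    i   : Carrier
    _+_ : Carrier → Carrier → Carrier
    ⅋-assoc : ∀ x y z → (x ⅋ᶠ y) ⅋ᶠ z ≡ x ⅋ᶠ (y ⅋ᶠ z)
    ⅋-comm  : ∀ x y → x ⅋ᶠ y ≡ y ⅋ᶠ x
    ⅋-idˡ   : ∀ x → i ⅋ᶠ x ≡ x
    ⅋-idʳ   : ∀ x → x ⅋ᶠ i ≡ x
    ⅋-mono  : ∀ {x x' y y'} → x ≤ x' → y ≤ y' → x ⅋ᶠ y ≤ x' ⅋ᶠ y'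
    ◁-assoc : ∀ x y z → (x ◁ y) ◁ z ≡ x ◁ (y ◁ z)
    ◁-idˡ   : ∀ x → i ◁ x ≡ x
    ◁-idʳ   : ∀ x → x ◁ i ≡ x
    ◁-mono  : ∀ {x x' y y'} → x ≤ x' → y ≤ y' → x ◁ y ≤ x' ◁ y'
    +-mono  : ∀ {x x' y y'} → x ≤ x' → y ≤ y' → x + y ≤ x' + y'
    seq-⅋   : ∀ w x y z → (w ◁ x) ⅋ᶠ (y ◁ z) ≤ (w ⅋ᶠ y) ◁ (x ⅋ᶠ z)
    +-⅋     : ∀ x y z → (x + y) ⅋ᶠ z ≤ (x ⅋ᶠ z) + (y ⅋ᶠ z)
    seq-+   : ∀ w x y z → (w ◁ x) + (y ◁ z) ≤ (w + y) ◁ (x + z)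
    i+i     : i + i ≤ i

module Chu (F : MAVFrame) where
  open MAVFrame F

  Subset : Set₁
  Subset = Pred Carrier 0ℓ

  η : Carrier → Subset
  η x y = y ≤ x

  data PlusComb (X : Subset) : Carrier → Set where
    leaf : ∀ {x} → X x → PlusComb X x
    node : ∀ {x y} → PlusComb X x → PlusComb X y → PlusComb X (x + y)

  α : Subset → Subset
  α X x = ∃ λ y → PlusComb X y × x ≤ y

  DownClosed : Subset → Set
  DownClosed X = ∀ {x y} → X x → y ≤ x → X y

  PlusClosed : Subset → Set
  PlusClosed X = ∀ {x y} → X x → X y → X (x + y)

  _∨ˢ_ : Subset → Subset → Subset
  X ∨ˢ Y = α (λ z → X z ⊎ Y z)

  K : Subset
  K = η i

  _⊛_ : Subset → Subset → Subset
  X ⊛ Y = α (λ z → ∃ λ x → ∃ λ y → X x × Y y × z ≤ x ⅋ᶠ y)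

  _◁ˢ_ : Subset → Subset → Subset
  X ◁ˢ Y = λ z → ∃ λ x → ∃ λ y → X x × Y y × z ≤ x ◁ y

  _⊸_ : Subset → Subset → Subset
  X ⊸ Y = λ z → ∀ {x} → X x → Y (z ⅋ᶠ x)

  _∩_ : Subset → Subset → Subset
  X ∩ Y = λ z → X z × Y z

  record Pair : Set₁ where
    constructor ⟨_,_⟩
    field
      pos : Subset
      neg : Subset
  open Pair public

  record ChuElem : Set₁ where
    field
      pair      : Pair
      pos-down  : DownClosed (pos pair)
      pos-plus  : PlusClosed (pos pair)
      neg-down  : DownClosed (neg pair)
      neg-plus  : PlusClosed (neg pair)
      chu       : (pos pair ⊛ neg pair) ⊆ K
  open ChuElem public

  infix 4 _⊑_
  _⊑_ : Pair → Pair → Set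
  X ⊑ Y = (pos X ⊆ pos Y) × (neg Y ⊆ neg X)

  _⊗ᶜ_ : Pair → Pair → Pair
  X ⊗ᶜ Y = ⟨ pos X ⊛ pos Y , (pos Y ⊸ neg X) ∩ (pos X ⊸ neg Y) ⟩

  Iᶜ : Pair
  Iᶜ = ⟨ K , K ⟩

  ¬ᶜ : Pair → Pair
  ¬ᶜ X = ⟨ neg X , pos X ⟩

  _◁ᶜ_ : Pair → Pair → Pair
  X ◁ᶜ Y = ⟨ pos X ◁ˢ pos Y , neg X ◁ˢ neg Y ⟩

  _&ᶜ_ : Pair → Pair → Pair
  X &ᶜ Y = ⟨ pos X ∩ pos Y , neg X ∨ˢ neg Y ⟩

  ⟦_⟧ : {A : Set} → Str A → (A → ChuElem) → Pair
  ⟦ atom a  ⟧ V = pair (V a)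
  ⟦ natom a ⟧ V = ¬ᶜ (pair (V a))
  ⟦ 𝟏       ⟧ V = Iᶜ
  ⟦ P ⨾ Q   ⟧ V = ⟦ P ⟧ V ◁ᶜ ⟦ Q ⟧ V
  ⟦ P ⊗ Q   ⟧ V = ⟦ P ⟧ V ⊗ᶜ ⟦ Q ⟧ V
  ⟦ P ⅋ Q   ⟧ V = ¬ᶜ (¬ᶜ (⟦ P ⟧ V) ⊗ᶜ ¬ᶜ (⟦ Q ⟧ V))
  ⟦ P & Q   ⟧ V = ⟦ P ⟧ V &ᶜ ⟦ Q ⟧ V
  ⟦ P ⊕ Q   ⟧ V = ¬ᶜ (¬ᶜ (⟦ P ⟧ V) &ᶜ ¬ᶜ (⟦ Q ⟧ V))

{-# OPTIONS --safe #-}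
module Submission where

-- Soundness is checked one rewrite rule at a time: a step P ⟶ Q yields
-- ⟦ Q ⟧ ⊑ ⟦ P ⟧, and congruent structures get ⊑-equivalent meanings.
-- Since ⟦_⟧ is defined on raw pairs of subsets, the unit and
-- associativity laws and the interaction, switch and external rules need
-- the invariant that every ⟦ P ⟧ is a genuine Chu element: both
-- components closed (downwards and under +) and orthogonal.
-- On subsets, α is the closure operator for that closedness and ⊛ is
-- residuated by ⊸. The frame axioms enter as follows: seq-⅋ gives
-- orthogonality of ◁ᶜ and the sequence rule, +-⅋ closedness of X ⊸ T,
-- seq-+ closedness of X ◁ˢ Y, and i + i ≤ i closedness of K.
-- Each co-rule is the ¬ᶜ-mirror of its rule, because ¬ᶜ is a
-- definitional involution that reverses ⊑.

open import Defs
open import Algebra.Bundles using (CommutativeSemigroup)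
open import Data.Product using (_×_; _,_; proj₁; proj₂)
open import Data.Sum using (inj₁; inj₂)
open import Relation.Binary.Bundles using (Poset)
open import Relation.Binary.Core using (_Preserves₂_⟶_⟶_)
open import Relation.Binary.PropositionalEquality
  using (_≡_; refl; sym; cong₂; subst; isEquivalence)
open import Relation.Unary using (_⊆_)

module Soundness (F : MAVFrame) where
  open MAVFrame F
  open Chu F

  ≤-poset : Poset _ _ _
  ≤-poset = record
    { isPartialOrder = record
      { isPreorder = record
        { isEquivalence = isEquivalence
        ; reflexive     = λ { refl → ≤-refl }
        ; trans         = ≤-trans
        }
      ; antisym = ≤-antisym
      }
    }

  ⅋-commutativeSemigroup : CommutativeSemigroup _ _
  ⅋-commutativeSemigroup = record
    { _∙_ = _⅋ᶠ_
    ; isCommutativeSemigroup = record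
      { isSemigroup = record
        { isMagma = record { isEquivalence = isEquivalence ; ∙-cong = cong₂ _⅋ᶠ_ }
        ; assoc   = ⅋-assoc
        }
      ; comm = ⅋-comm
      }
    }

  open Poset ≤-poset using () renaming (reflexive to ≤-reflexive)
  open import Relation.Binary.Reasoning.PartialOrder ≤-poset
  open import Algebra.Properties.CommutativeSemigroup ⅋-commutativeSemigroup

  ⅋-+ : ∀ x y z → x ⅋ᶠ (y + z) ≤ (x ⅋ᶠ y) + (x ⅋ᶠ z)
  ⅋-+ x y z = begin
    x ⅋ᶠ (y + z)            ≡⟨ ⅋-comm x (y + z) ⟩
    (y + z) ⅋ᶠ x            ≤⟨ +-⅋ y z x ⟩
    (y ⅋ᶠ x) + (z ⅋ᶠ x)     ≡⟨ cong₂ _+_ (⅋-comm y x) (⅋-comm z x) ⟩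
    (x ⅋ᶠ y) + (x ⅋ᶠ z)     ∎

  ⅋-K-≤ : ∀ {k} x → K k → x ⅋ᶠ k ≤ x
  ⅋-K-≤ x k≤i = ≤-trans (⅋-mono ≤-refl k≤i) (≤-reflexive (⅋-idʳ x))

  K-⅋-≤ : ∀ {k} x → K k → k ⅋ᶠ x ≤ x
  K-⅋-≤ x k≤i = ≤-trans (⅋-mono k≤i ≤-refl) (≤-reflexive (⅋-idˡ x))

  record IsClosed (X : Subset) : Set where
    field
      down-closed : DownClosed X
      plus-closed : PlusClosed X
  open IsClosed

  K-closed : IsClosed K
  K-closed = record
    { down-closed = λ k≤i y≤k → ≤-trans y≤k k≤i
    ; plus-closed = λ k≤i k'≤i → ≤-trans (+-mono k≤i k'≤i) i+i
    }

  ∩-closed : ∀ {X Y} → IsClosed X → IsClosed Y → IsClosed (X ∩ Y)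
  ∩-closed cX cY = record
    { down-closed = λ (x , y) le → down-closed cX x le , down-closed cY y le
    ; plus-closed = λ (x , y) (x' , y') → plus-closed cX x x' , plus-closed cY y y'
    }

  ⊸-closed : ∀ {X T} → IsClosed T → IsClosed (X ⊸ T)
  ⊸-closed cT = record
    { down-closed = λ f le x → down-closed cT (f x) (⅋-mono le ≤-refl)
    ; plus-closed = λ f g x → down-closed cT (plus-closed cT (f x) (g x)) (+-⅋ _ _ _)
    }

  ⅋-preimage-closed : ∀ {T} x → IsClosed T → IsClosed (λ y → T (x ⅋ᶠ y))
  ⅋-preimage-closed x cT = record
    { down-closed = λ t le → down-closed cT t (⅋-mono ≤-refl le)
    ; plus-closed = λ t t' → down-closed cT (plus-closed cT t t') (⅋-+ x _ _)
    }

  ◁ˢ-closed : ∀ {X Y} → PlusClosed X → PlusClosed Y → IsClosed (X ◁ˢ Y)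
  ◁ˢ-closed pX pY = record
    { down-closed = λ (x , y , px , py , le) le' → x , y , px , py , ≤-trans le' le
    ; plus-closed = λ (x , y , px , py , le) (x' , y' , px' , py' , le') →
        x + x' , y + y' , pX px px' , pY py py' ,
        ≤-trans (+-mono le le') (seq-+ x y x' y')
    }

  α-closed : ∀ {X} → IsClosed (α X)
  α-closed = record
    { down-closed = λ (y , c , le) le' → y , c , ≤-trans le' le
    ; plus-closed = λ (y , c , le) (y' , c' , le') → y + y' , node c c' , +-mono le le'
    }

  α-extensive : ∀ {X} → X ⊆ α X
  α-extensive x = _ , leaf x , ≤-refl

  α-least : ∀ {X T} → IsClosed T → X ⊆ T → α X ⊆ T
  α-least {X} {T} cT X⊆T (y , c , le) = down-closed cT (combination c) le
    where
    combination : ∀ {y} → PlusComb X y → T y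
    combination (leaf x)    = X⊆T x
    combination (node c c') = plus-closed cT (combination c) (combination c')

  α-mono : ∀ {X Y} → X ⊆ Y → α X ⊆ α Y
  α-mono X⊆Y = α-least α-closed (λ x → α-extensive (X⊆Y x))

  ∨ˢ-inj₁ : ∀ {X Y} → X ⊆ (X ∨ˢ Y)
  ∨ˢ-inj₁ x = α-extensive (inj₁ x)

  ∨ˢ-inj₂ : ∀ {X Y} → Y ⊆ (X ∨ˢ Y)
  ∨ˢ-inj₂ y = α-extensive (inj₂ y)

  ⊛-intro : ∀ {X Y x y} → X x → Y y → (X ⊛ Y) (x ⅋ᶠ y)
  ⊛-intro px py = α-extensive (_ , _ , px , py , ≤-refl)

  ⊛-residual : ∀ {X Y T} → IsClosed T → X ⊆ (Y ⊸ T) → (X ⊛ Y) ⊆ T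
  ⊛-residual cT f = α-least cT (λ (x , y , px , py , le) → down-closed cT (f px py) le)

  ⊛-mono : ∀ {X X' Y Y'} → X ⊆ X' → Y ⊆ Y' → (X ⊛ Y) ⊆ (X' ⊛ Y')
  ⊛-mono f g = ⊛-residual α-closed (λ px py → ⊛-intro (f px) (g py))

  ⊛-comm : ∀ {X Y} → (X ⊛ Y) ⊆ (Y ⊛ X)
  ⊛-comm {X} {Y} = ⊛-residual α-closed
    (λ {x} px {y} py → subst (Y ⊛ X) (⅋-comm y x) (⊛-intro py px))

  ⊸-α : ∀ {X T} → IsClosed T → (X ⊸ T) ⊆ (α X ⊸ T)
  ⊸-α cT {z} f = α-least (⅋-preimage-closed z cT) f

  ⊸-uncurry : ∀ {X Y T} → IsClosed T → (X ⊸ (Y ⊸ T)) ⊆ ((X ⊛ Y) ⊸ T)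
  ⊸-uncurry {T = T} cT {z} f = ⊛-residual (⅋-preimage-closed z cT)
    (λ {x} px {y} py → subst T (⅋-assoc z x y) (f px py))

  ⊛-distribʳ-∨ˢ : ∀ {X Y Z} → ((X ∨ˢ Y) ⊛ Z) ⊆ ((X ⊛ Z) ∨ˢ (Y ⊛ Z))
  ⊛-distribʳ-∨ˢ = ⊛-residual α-closed (α-least (⊸-closed α-closed)
    λ { (inj₁ px) pz → ∨ˢ-inj₁ (⊛-intro px pz)
      ; (inj₂ py) pz → ∨ˢ-inj₂ (⊛-intro py pz) })

  ◁ˢ-mono : ∀ {X X' Y Y'} → X ⊆ X' → Y ⊆ Y' → (X ◁ˢ Y) ⊆ (X' ◁ˢ Y')
  ◁ˢ-mono f g (x , y , px , py , le) = x , y , f px , g py , le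

  ◁ˢ-⊸ : ∀ {X X' Y Y'} → ((X ⊸ X') ◁ˢ (Y ⊸ Y')) ⊆ ((X ◁ˢ Y) ⊸ (X' ◁ˢ Y'))
  ◁ˢ-⊸ (a , b , fa , fb , le) (x , y , px , py , le') =
    a ⅋ᶠ x , b ⅋ᶠ y , fa px , fb py , ≤-trans (⅋-mono le le') (seq-⅋ a b x y)

  ◁ˢ-assoc-⊆ : ∀ {X Y Z} → ((X ◁ˢ Y) ◁ˢ Z) ⊆ (X ◁ˢ (Y ◁ˢ Z))
  ◁ˢ-assoc-⊆ (w , z , (x , y , px , py , w≤) , pz , le) =
    x , y ◁ z , px , (y , z , py , pz , ≤-refl) ,
    ≤-trans le (≤-trans (◁-mono w≤ ≤-refl) (≤-reflexive (◁-assoc x y z)))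

  ◁ˢ-assoc-⊇ : ∀ {X Y Z} → (X ◁ˢ (Y ◁ˢ Z)) ⊆ ((X ◁ˢ Y) ◁ˢ Z)
  ◁ˢ-assoc-⊇ (x , w , px , (y , z , py , pz , w≤) , le) =
    x ◁ y , z , (x , y , px , py , ≤-refl) , pz ,
    ≤-trans le (≤-trans (◁-mono ≤-refl w≤) (≤-reflexive (sym (◁-assoc x y z))))

  ◁ˢ-identityˡ-⊆ : ∀ {X} → DownClosed X → (K ◁ˢ X) ⊆ X
  ◁ˢ-identityˡ-⊆ down (k , x , k≤i , px , le) =
    down px (≤-trans le (≤-trans (◁-mono k≤i ≤-refl) (≤-reflexive (◁-idˡ x))))

  ◁ˢ-identityʳ-⊆ : ∀ {X} → DownClosed X → (X ◁ˢ K) ⊆ X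
  ◁ˢ-identityʳ-⊆ down (x , k , px , k≤i , le) =
    down px (≤-trans le (≤-trans (◁-mono ≤-refl k≤i) (≤-reflexive (◁-idʳ x))))

  ◁ˢ-identityˡ-⊇ : ∀ {X} → X ⊆ (K ◁ˢ X)
  ◁ˢ-identityˡ-⊇ {x = x} px = i , x , ≤-refl , px , ≤-reflexive (sym (◁-idˡ x))

  ◁ˢ-identityʳ-⊇ : ∀ {X} → X ⊆ (X ◁ˢ K)
  ◁ˢ-identityʳ-⊇ {x = x} px = x , i , px , ≤-refl , ≤-reflexive (sym (◁-idʳ x))

  _⅋ᶜ_ : Pair → Pair → Pair
  X ⅋ᶜ Y = ¬ᶜ (¬ᶜ X ⊗ᶜ ¬ᶜ Y)

  _⊕ᶜ_ : Pair → Pair → Pair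
  X ⊕ᶜ Y = ¬ᶜ (¬ᶜ X &ᶜ ¬ᶜ Y)

  record IsChuPair (X : Pair) : Set where
    field
      pos-closed : IsClosed (pos X)
      neg-closed : IsClosed (neg X)
      orthogonal : pos X ⊆ (neg X ⊸ K)
  open IsChuPair

  elem-isChuPair : (E : ChuElem) → IsChuPair (pair E)
  elem-isChuPair E = record
    { pos-closed = record { down-closed = pos-down E ; plus-closed = pos-plus E }
    ; neg-closed = record { down-closed = neg-down E ; plus-closed = neg-plus E }
    ; orthogonal = λ px ny → chu E (⊛-intro px ny)
    }

  Iᶜ-isChuPair : IsChuPair Iᶜ
  Iᶜ-isChuPair = record
    { pos-closed = K-closed
    ; neg-closed = K-closed
    ; orthogonal = λ k≤i k'≤i → ≤-trans (⅋-mono k≤i k'≤i) (≤-reflexive (⅋-idˡ i))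
    }

  ¬ᶜ-isChuPair : ∀ {X} → IsChuPair X → IsChuPair (¬ᶜ X)
  ¬ᶜ-isChuPair g = record
    { pos-closed = neg-closed g
    ; neg-closed = pos-closed g
    ; orthogonal = λ {y} ny {x} px → subst K (⅋-comm x y) (orthogonal g px ny)
    }

  ⊗ᶜ-isChuPair : ∀ {X Y} → IsChuPair X → IsChuPair Y → IsChuPair (X ⊗ᶜ Y)
  ⊗ᶜ-isChuPair gX gY = record
    { pos-closed = α-closed
    ; neg-closed = ∩-closed (⊸-closed (neg-closed gX)) (⊸-closed (neg-closed gY))
    ; orthogonal = α-least (⊸-closed K-closed)
        λ {z} (x , y , px , py , le) {n} (n₁ , _) → begin
          z ⅋ᶠ n           ≤⟨ ⅋-mono le ≤-refl ⟩
          (x ⅋ᶠ y) ⅋ᶠ n    ≡⟨ xy∙z≈x∙zy x y n ⟩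
          x ⅋ᶠ (n ⅋ᶠ y)    ≤⟨ orthogonal gX px (n₁ py) ⟩
          i                ∎
    }

  ◁ᶜ-isChuPair : ∀ {X Y} → IsChuPair X → IsChuPair Y → IsChuPair (X ◁ᶜ Y)
  ◁ᶜ-isChuPair gX gY = record
    { pos-closed = ◁ˢ-closed (plus-closed (pos-closed gX)) (plus-closed (pos-closed gY))
    ; neg-closed = ◁ˢ-closed (plus-closed (neg-closed gX)) (plus-closed (neg-closed gY))
    ; orthogonal = λ {a} (x , y , px , py , le) {b} (x' , y' , nx , ny , le') → begin
        a ⅋ᶠ b                     ≤⟨ ⅋-mono le le' ⟩
        (x ◁ y) ⅋ᶠ (x' ◁ y')       ≤⟨ seq-⅋ x y x' y' ⟩
        (x ⅋ᶠ x') ◁ (y ⅋ᶠ y')      ≤⟨ ◁-mono (orthogonal gX px nx) (orthogonal gY py ny) ⟩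
        i ◁ i                      ≡⟨ ◁-idˡ i ⟩
        i                          ∎
    }

  &ᶜ-isChuPair : ∀ {X Y} → IsChuPair X → IsChuPair Y → IsChuPair (X &ᶜ Y)
  &ᶜ-isChuPair gX gY = record
    { pos-closed = ∩-closed (pos-closed gX) (pos-closed gY)
    ; neg-closed = α-closed
    ; orthogonal = λ (px , py) → ⊸-α K-closed
        λ { (inj₁ nx) → orthogonal gX px nx ; (inj₂ ny) → orthogonal gY py ny }
    }

  ⅋ᶜ-isChuPair : ∀ {X Y} → IsChuPair X → IsChuPair Y → IsChuPair (X ⅋ᶜ Y)
  ⅋ᶜ-isChuPair gX gY = ¬ᶜ-isChuPair (⊗ᶜ-isChuPair (¬ᶜ-isChuPair gX) (¬ᶜ-isChuPair gY))

  ⊕ᶜ-isChuPair : ∀ {X Y} → IsChuPair X → IsChuPair Y → IsChuPair (X ⊕ᶜ Y)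
  ⊕ᶜ-isChuPair gX gY = ¬ᶜ-isChuPair (&ᶜ-isChuPair (¬ᶜ-isChuPair gX) (¬ᶜ-isChuPair gY))

  ⊑-refl : ∀ {X} → X ⊑ X
  ⊑-refl = (λ x → x) , (λ x → x)

  ⊑-trans : ∀ {X Y Z} → X ⊑ Y → Y ⊑ Z → X ⊑ Z
  ⊑-trans (p , n) (p' , n') = (λ x → p' (p x)) , (λ x → n (n' x))

  ¬ᶜ-antitone : ∀ {X Y} → X ⊑ Y → ¬ᶜ Y ⊑ ¬ᶜ X
  ¬ᶜ-antitone (p , n) = n , p

  ⊗ᶜ-mono : _⊗ᶜ_ Preserves₂ _⊑_ ⟶ _⊑_ ⟶ _⊑_
  ⊗ᶜ-mono (p , n) (p' , n') =
    ⊛-mono p p' , λ (f , g) → (λ y → n (f (p' y))) , (λ x → n' (g (p x)))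

  ◁ᶜ-mono : _◁ᶜ_ Preserves₂ _⊑_ ⟶ _⊑_ ⟶ _⊑_
  ◁ᶜ-mono (p , n) (p' , n') = ◁ˢ-mono p p' , ◁ˢ-mono n n'

  &ᶜ-mono : _&ᶜ_ Preserves₂ _⊑_ ⟶ _⊑_ ⟶ _⊑_
  &ᶜ-mono (p , n) (p' , n') =
    (λ (x , y) → p x , p' y) , α-mono λ { (inj₁ x) → inj₁ (n x) ; (inj₂ y) → inj₂ (n' y) }

  ⅋ᶜ-mono : _⅋ᶜ_ Preserves₂ _⊑_ ⟶ _⊑_ ⟶ _⊑_
  ⅋ᶜ-mono X⊑X' Y⊑Y' = ¬ᶜ-antitone (⊗ᶜ-mono (¬ᶜ-antitone X⊑X') (¬ᶜ-antitone Y⊑Y'))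

  ⊕ᶜ-mono : _⊕ᶜ_ Preserves₂ _⊑_ ⟶ _⊑_ ⟶ _⊑_
  ⊕ᶜ-mono X⊑X' Y⊑Y' = ¬ᶜ-antitone (&ᶜ-mono (¬ᶜ-antitone X⊑X') (¬ᶜ-antitone Y⊑Y'))

  infix 4 _≅_
  _≅_ : Pair → Pair → Set
  X ≅ Y = X ⊑ Y × Y ⊑ X

  ≅-refl : ∀ {X} → X ≅ X
  ≅-refl = ⊑-refl , ⊑-refl

  ≅-sym : ∀ {X Y} → X ≅ Y → Y ≅ X
  ≅-sym (X⊑Y , Y⊑X) = Y⊑X , X⊑Y

  ≅-trans : ∀ {X Y Z} → X ≅ Y → Y ≅ Z → X ≅ Z
  ≅-trans (X⊑Y , Y⊑X) (Y⊑Z , Z⊑Y) = ⊑-trans X⊑Y Y⊑Z , ⊑-trans Z⊑Y Y⊑X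

  ≅-¬ᶜ : ∀ {X Y} → X ≅ Y → ¬ᶜ X ≅ ¬ᶜ Y
  ≅-¬ᶜ (X⊑Y , Y⊑X) = ¬ᶜ-antitone Y⊑X , ¬ᶜ-antitone X⊑Y

  ≅-cong₂ : ∀ {f : Pair → Pair → Pair} →
            f Preserves₂ _⊑_ ⟶ _⊑_ ⟶ _⊑_ → f Preserves₂ _≅_ ⟶ _≅_ ⟶ _≅_
  ≅-cong₂ mono (X⊑X' , X'⊑X) (Y⊑Y' , Y'⊑Y) = mono X⊑X' Y⊑Y' , mono X'⊑X Y'⊑Y

  ◁ᶜ-assoc : ∀ {X Y Z} → ((X ◁ᶜ Y) ◁ᶜ Z) ≅ (X ◁ᶜ (Y ◁ᶜ Z))
  ◁ᶜ-assoc = (◁ˢ-assoc-⊆ , ◁ˢ-assoc-⊇) , (◁ˢ-assoc-⊇ , ◁ˢ-assoc-⊆)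

  ◁ᶜ-identityˡ : ∀ {X} → IsChuPair X → (Iᶜ ◁ᶜ X) ≅ X
  ◁ᶜ-identityˡ g = (◁ˢ-identityˡ-⊆ (down-closed (pos-closed g)) , ◁ˢ-identityˡ-⊇)
                 , (◁ˢ-identityˡ-⊇ , ◁ˢ-identityˡ-⊆ (down-closed (neg-closed g)))

  ◁ᶜ-identityʳ : ∀ {X} → IsChuPair X → (X ◁ᶜ Iᶜ) ≅ X
  ◁ᶜ-identityʳ g = (◁ˢ-identityʳ-⊆ (down-closed (pos-closed g)) , ◁ˢ-identityʳ-⊇)
                 , (◁ˢ-identityʳ-⊇ , ◁ˢ-identityʳ-⊆ (down-closed (neg-closed g)))

  ⊗ᶜ-comm : ∀ X Y → (X ⊗ᶜ Y) ⊑ (Y ⊗ᶜ X)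
  ⊗ᶜ-comm _ _ = ⊛-comm , λ (f , g) → g , f

  ⊗ᶜ-assoc-⊑ : ∀ {X Y Z} → IsClosed (neg Z) → ((X ⊗ᶜ Y) ⊗ᶜ Z) ⊑ (X ⊗ᶜ (Y ⊗ᶜ Z))
  ⊗ᶜ-assoc-⊑ {X} {Y} {Z} cZ = pos-assoc , neg-assoc
    where
    pos-assoc : ((pos X ⊛ pos Y) ⊛ pos Z) ⊆ (pos X ⊛ (pos Y ⊛ pos Z))
    pos-assoc = ⊛-residual α-closed (⊛-residual (⊸-closed α-closed)
      λ {x} px {y} py {z} pz →
        subst (pos X ⊛ (pos Y ⊛ pos Z)) (sym (⅋-assoc x y z)) (⊛-intro px (⊛-intro py pz)))

    neg-assoc : neg (X ⊗ᶜ (Y ⊗ᶜ Z)) ⊆ neg ((X ⊗ᶜ Y) ⊗ᶜ Z)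
    neg-assoc {n} (f , g) =
        (λ {z} pz → (λ {y} py → subst (neg X) (sym (xy∙z≈x∙zy n z y)) (f (⊛-intro py pz)))
                  , (λ {x} px → subst (neg Y) (xy∙z≈xz∙y n x z) (proj₁ (g px) pz)))
      , ⊸-uncurry cZ (λ px py → proj₂ (g px) py)

  ⊗ᶜ-assoc-⊒ : ∀ {X Y Z} → IsClosed (neg X) → IsClosed (neg Y) →
               (X ⊗ᶜ (Y ⊗ᶜ Z)) ⊑ ((X ⊗ᶜ Y) ⊗ᶜ Z)
  ⊗ᶜ-assoc-⊒ {X} {Y} {Z} cX cY =
    ⊑-trans (⊗ᶜ-comm X (Y ⊗ᶜ Z))
   (⊑-trans (⊗ᶜ-assoc-⊑ {Y} {Z} {X} cX)
   (⊑-trans (⊗ᶜ-comm Y (Z ⊗ᶜ X))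
   (⊑-trans (⊗ᶜ-assoc-⊑ {Z} {X} {Y} cY)
            (⊗ᶜ-comm Z (X ⊗ᶜ Y)))))

  ⊗ᶜ-assoc : ∀ {X Y Z} → IsChuPair X → IsChuPair Y → IsChuPair Z →
             ((X ⊗ᶜ Y) ⊗ᶜ Z) ≅ (X ⊗ᶜ (Y ⊗ᶜ Z))
  ⊗ᶜ-assoc {X} {Y} {Z} gX gY gZ =
    ⊗ᶜ-assoc-⊑ {X} {Y} (neg-closed gZ) , ⊗ᶜ-assoc-⊒ {Z = Z} (neg-closed gX) (neg-closed gY)

  ⊗ᶜ-identityʳ : ∀ {X} → IsChuPair X → (X ⊗ᶜ Iᶜ) ≅ X
  ⊗ᶜ-identityʳ {X} g =
      ( ⊛-residual (pos-closed g) (λ {x} px pk → down-closed (pos-closed g) px (⅋-K-≤ x pk))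
      , λ {n} pn → (λ pk → down-closed (neg-closed g) pn (⅋-K-≤ n pk))
                 , orthogonal (¬ᶜ-isChuPair g) pn )
    , ( (λ {x} px → subst (pos X ⊛ K) (⅋-idʳ x) (⊛-intro px (≤-refl {i})))
      , λ {n} (f , _) → subst (neg X) (⅋-idʳ n) (f (≤-refl {i})) )

  axᶜ : ∀ {X} → IsChuPair X → Iᶜ ⊑ (X ⅋ᶜ ¬ᶜ X)
  axᶜ g = (λ {k} pk → (λ {x} px → down-closed (pos-closed g) px (K-⅋-≤ x pk))
                    , (λ {n} pn → down-closed (neg-closed g) pn (K-⅋-≤ n pk)))
        , ⊛-residual K-closed (orthogonal (¬ᶜ-isChuPair g))

  switchᶜ : ∀ {X Y Z} → IsClosed (neg X) → IsClosed (pos Z) →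
            (X ⊗ᶜ (Y ⅋ᶜ Z)) ⊑ ((X ⊗ᶜ Y) ⅋ᶜ Z)
  switchᶜ {X} {Y} {Z} cX cZ =
      ⊛-residual (∩-closed (⊸-closed α-closed) (⊸-closed cZ))
        (λ {x} px {w} (f , g) →
            (λ {c} nc → subst (pos X ⊛ pos Y) (sym (⅋-assoc x w c)) (⊛-intro px (f nc)))
          , (λ {n} (_ , h) → subst (pos Z) (sym (xy∙z≈y∙zx x w n)) (g (h px))))
    , ⊛-residual (∩-closed (⊸-closed cX) (⊸-closed α-closed))
        (λ {n} (f , g) {c} nc →
            (λ {w} (h , _) → subst (neg X) (sym (xy∙z≈x∙zy n c w)) (f (h nc)))
          , (λ {x} px → subst (neg Y ⊛ neg Z) (xy∙z≈xz∙y n x c) (⊛-intro (g px) nc)))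

  tidyᶜ : Iᶜ ⊑ (Iᶜ &ᶜ Iᶜ)
  tidyᶜ = (λ k → k , k) , α-least K-closed λ { (inj₁ k) → k ; (inj₂ k) → k }

  seqᶜ : ∀ {P Q R S} → ((P ⅋ᶜ R) ◁ᶜ (Q ⅋ᶜ S)) ⊑ ((P ◁ᶜ Q) ⅋ᶜ (R ◁ᶜ S))
  seqᶜ = (λ t → ◁ˢ-⊸ (◁ˢ-mono proj₁ proj₁ t) , ◁ˢ-⊸ (◁ˢ-mono proj₂ proj₂ t))
       , ⊛-residual (◁ˢ-closed (plus-closed α-closed) (plus-closed α-closed))
           (λ t → ◁ˢ-⊸ (◁ˢ-mono (λ p {_} r → ⊛-intro p r) (λ q {_} s → ⊛-intro q s) t))

  leftᶜ : ∀ {X Y} → X ⊑ (X ⊕ᶜ Y)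
  leftᶜ = ∨ˢ-inj₁ , proj₁

  rightᶜ : ∀ {X Y} → Y ⊑ (X ⊕ᶜ Y)
  rightᶜ = ∨ˢ-inj₂ , proj₂

  extᶜ : ∀ {X Y Z} → IsClosed (pos Z) → ((X ⅋ᶜ Z) &ᶜ (Y ⅋ᶜ Z)) ⊑ ((X &ᶜ Y) ⅋ᶜ Z)
  extᶜ cZ = (λ ((f , g) , (f' , g')) →
                (λ nz → f nz , f' nz)
              , ⊸-α cZ λ { (inj₁ nx) → g nx ; (inj₂ ny) → g' ny })
          , ⊛-distribʳ-∨ˢ

  medialᶜ : ∀ {P Q R S} → ((P &ᶜ R) ◁ᶜ (Q &ᶜ S)) ⊑ ((P ◁ᶜ Q) &ᶜ (R ◁ᶜ S))
  medialᶜ = (λ t → ◁ˢ-mono proj₁ proj₁ t , ◁ˢ-mono proj₂ proj₂ t)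
          , α-least (◁ˢ-closed (plus-closed α-closed) (plus-closed α-closed))
              λ { (inj₁ t) → ◁ˢ-mono ∨ˢ-inj₁ ∨ˢ-inj₁ t
                ; (inj₂ t) → ◁ˢ-mono ∨ˢ-inj₂ ∨ˢ-inj₂ t }

  &ᶜ-projˡ : ∀ {X Y} → (X &ᶜ Y) ⊑ X
  &ᶜ-projˡ = proj₁ , ∨ˢ-inj₁

  &ᶜ-projʳ : ∀ {X Y} → (X &ᶜ Y) ⊑ Y
  &ᶜ-projʳ = proj₂ , ∨ˢ-inj₂

  module Interpretation {A : Set} (V : A → ChuElem) where

    ⟦⟧-isChuPair : ∀ P → IsChuPair (⟦ P ⟧ V)
    ⟦⟧-isChuPair (atom a)  = elem-isChuPair (V a)
    ⟦⟧-isChuPair (natom a) = ¬ᶜ-isChuPair (elem-isChuPair (V a))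
    ⟦⟧-isChuPair 𝟏         = Iᶜ-isChuPair
    ⟦⟧-isChuPair (P ⨾ Q)   = ◁ᶜ-isChuPair (⟦⟧-isChuPair P) (⟦⟧-isChuPair Q)
    ⟦⟧-isChuPair (P ⊗ Q)   = ⊗ᶜ-isChuPair (⟦⟧-isChuPair P) (⟦⟧-isChuPair Q)
    ⟦⟧-isChuPair (P ⅋ Q)   = ⅋ᶜ-isChuPair (⟦⟧-isChuPair P) (⟦⟧-isChuPair Q)
    ⟦⟧-isChuPair (P & Q)   = &ᶜ-isChuPair (⟦⟧-isChuPair P) (⟦⟧-isChuPair Q)
    ⟦⟧-isChuPair (P ⊕ Q)   = ⊕ᶜ-isChuPair (⟦⟧-isChuPair P) (⟦⟧-isChuPair Q)

    ¬⟦⟧-isChuPair : ∀ P → IsChuPair (¬ᶜ (⟦ P ⟧ V))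
    ¬⟦⟧-isChuPair P = ¬ᶜ-isChuPair (⟦⟧-isChuPair P)

    ⟦⊥⟧ : ∀ P → ⟦ P ⊥ ⟧ V ≡ ¬ᶜ (⟦ P ⟧ V)
    ⟦⊥⟧ (atom a)  = refl
    ⟦⊥⟧ (natom a) = refl
    ⟦⊥⟧ 𝟏         = refl
    ⟦⊥⟧ (P ⨾ Q)   = cong₂ _◁ᶜ_ (⟦⊥⟧ P) (⟦⊥⟧ Q)
    ⟦⊥⟧ (P ⊗ Q)   = cong₂ _⅋ᶜ_ (⟦⊥⟧ P) (⟦⊥⟧ Q)
    ⟦⊥⟧ (P ⅋ Q)   = cong₂ _⊗ᶜ_ (⟦⊥⟧ P) (⟦⊥⟧ Q)
    ⟦⊥⟧ (P & Q)   = cong₂ _⊕ᶜ_ (⟦⊥⟧ P) (⟦⊥⟧ Q)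
    ⟦⊥⟧ (P ⊕ Q)   = cong₂ _&ᶜ_ (⟦⊥⟧ P) (⟦⊥⟧ Q)

    ≈-sound : ∀ {P Q} → P ≈ Q → ⟦ P ⟧ V ≅ ⟦ Q ⟧ V
    ≈-sound ≈-refl           = ≅-refl
    ≈-sound (≈-sym e)        = ≅-sym (≈-sound e)
    ≈-sound (≈-trans e e')   = ≅-trans (≈-sound e) (≈-sound e')
    ≈-sound (s⨾-cong e e')   = ≅-cong₂ ◁ᶜ-mono (≈-sound e) (≈-sound e')
    ≈-sound (s⊗-cong e e')   = ≅-cong₂ ⊗ᶜ-mono (≈-sound e) (≈-sound e')
    ≈-sound (s⅋-cong e e')   = ≅-cong₂ ⅋ᶜ-mono (≈-sound e) (≈-sound e')
    ≈-sound (s&-cong e e')   = ≅-cong₂ &ᶜ-mono (≈-sound e) (≈-sound e')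
    ≈-sound (s⊕-cong e e')   = ≅-cong₂ ⊕ᶜ-mono (≈-sound e) (≈-sound e')
    ≈-sound s⨾-assoc         = ◁ᶜ-assoc
    ≈-sound (s⨾-idˡ {P})     = ◁ᶜ-identityˡ (⟦⟧-isChuPair P)
    ≈-sound (s⨾-idʳ {P})     = ◁ᶜ-identityʳ (⟦⟧-isChuPair P)
    ≈-sound (s⊗-assoc {P} {Q} {R}) =
      ⊗ᶜ-assoc (⟦⟧-isChuPair P) (⟦⟧-isChuPair Q) (⟦⟧-isChuPair R)
    ≈-sound (s⊗-comm {P} {Q}) = ⊗ᶜ-comm (⟦ P ⟧ V) (⟦ Q ⟧ V) , ⊗ᶜ-comm (⟦ Q ⟧ V) (⟦ P ⟧ V)
    ≈-sound (s⊗-idʳ {P})     = ⊗ᶜ-identityʳ (⟦⟧-isChuPair P)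
    ≈-sound (s⅋-assoc {P} {Q} {R}) =
      ≅-¬ᶜ (⊗ᶜ-assoc (¬⟦⟧-isChuPair P) (¬⟦⟧-isChuPair Q) (¬⟦⟧-isChuPair R))
    ≈-sound (s⅋-comm {P} {Q}) =
      ≅-¬ᶜ (⊗ᶜ-comm (¬ᶜ (⟦ P ⟧ V)) (¬ᶜ (⟦ Q ⟧ V)) , ⊗ᶜ-comm (¬ᶜ (⟦ Q ⟧ V)) (¬ᶜ (⟦ P ⟧ V)))
    ≈-sound (s⅋-idʳ {P})     = ≅-¬ᶜ (⊗ᶜ-identityʳ (¬⟦⟧-isChuPair P))

    rule-sound : ∀ {P Q} → Rule P Q → ⟦ Q ⟧ V ⊑ ⟦ P ⟧ V
    rule-sound (r-ax {P}) =
      subst (λ Y → Iᶜ ⊑ (⟦ P ⟧ V ⅋ᶜ Y)) (sym (⟦⊥⟧ P)) (axᶜ (⟦⟧-isChuPair P))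
    rule-sound (r-switch {P} {Q} {R}) =
      switchᶜ (neg-closed (⟦⟧-isChuPair P)) (pos-closed (⟦⟧-isChuPair R))
    rule-sound r-tidy = tidyᶜ
    rule-sound (r-seq {P} {Q} {R} {S}) = seqᶜ {⟦ P ⟧ V} {⟦ Q ⟧ V} {⟦ R ⟧ V} {⟦ S ⟧ V}
    rule-sound (r-left {P} {Q}) = leftᶜ {⟦ P ⟧ V} {⟦ Q ⟧ V}
    rule-sound (r-right {P} {Q}) = rightᶜ {⟦ P ⟧ V} {⟦ Q ⟧ V}
    rule-sound (r-ext {P} {Q} {R}) = extᶜ {⟦ P ⟧ V} {⟦ Q ⟧ V} (pos-closed (⟦⟧-isChuPair R))
    rule-sound (r-medial {P} {Q} {R} {S}) = medialᶜ {⟦ P ⟧ V} {⟦ Q ⟧ V} {⟦ R ⟧ V} {⟦ S ⟧ V}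
    rule-sound (r-coax {P}) =
      subst (λ Y → (⟦ P ⟧ V ⊗ᶜ Y) ⊑ Iᶜ) (sym (⟦⊥⟧ P))
        (¬ᶜ-antitone (axᶜ (¬⟦⟧-isChuPair P)))
    rule-sound r-cotidy = ¬ᶜ-antitone tidyᶜ
    rule-sound (r-coseq {P} {Q} {R} {S}) =
      ¬ᶜ-antitone (seqᶜ {¬ᶜ (⟦ P ⟧ V)} {¬ᶜ (⟦ Q ⟧ V)} {¬ᶜ (⟦ R ⟧ V)} {¬ᶜ (⟦ S ⟧ V)})
    rule-sound (r-coleft {P} {Q}) = &ᶜ-projˡ {⟦ P ⟧ V} {⟦ Q ⟧ V}
    rule-sound (r-coright {P} {Q}) = &ᶜ-projʳ {⟦ P ⟧ V} {⟦ Q ⟧ V}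
    rule-sound (r-coext {P} {Q} {R}) =
      ¬ᶜ-antitone (extᶜ {¬ᶜ (⟦ P ⟧ V)} {¬ᶜ (⟦ Q ⟧ V)} (neg-closed (⟦⟧-isChuPair R)))
    rule-sound (r-comedial {P} {Q} {R} {S}) =
      ¬ᶜ-antitone (medialᶜ {¬ᶜ (⟦ P ⟧ V)} {¬ᶜ (⟦ Q ⟧ V)} {¬ᶜ (⟦ R ⟧ V)} {¬ᶜ (⟦ S ⟧ V)})

    ↝-sound : ∀ {P Q} → P ↝ Q → ⟦ Q ⟧ V ⊑ ⟦ P ⟧ V
    ↝-sound (root r)       = rule-sound r
    ↝-sound (⨾ˡ {R = R} r) = ◁ᶜ-mono (↝-sound r) (⊑-refl {⟦ R ⟧ V})
    ↝-sound (⨾ʳ {R = R} r) = ◁ᶜ-mono (⊑-refl {⟦ R ⟧ V}) (↝-sound r)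
    ↝-sound (⊗ˡ {R = R} r) = ⊗ᶜ-mono (↝-sound r) (⊑-refl {⟦ R ⟧ V})
    ↝-sound (⊗ʳ {R = R} r) = ⊗ᶜ-mono (⊑-refl {⟦ R ⟧ V}) (↝-sound r)
    ↝-sound (⅋ˡ {R = R} r) = ⅋ᶜ-mono (↝-sound r) (⊑-refl {⟦ R ⟧ V})
    ↝-sound (⅋ʳ {R = R} r) = ⅋ᶜ-mono (⊑-refl {⟦ R ⟧ V}) (↝-sound r)
    ↝-sound (&ˡ {R = R} r) = &ᶜ-mono (↝-sound r) (⊑-refl {⟦ R ⟧ V})
    ↝-sound (&ʳ {R = R} r) = &ᶜ-mono (⊑-refl {⟦ R ⟧ V}) (↝-sound r)
    ↝-sound (⊕ˡ {R = R} r) = ⊕ᶜ-mono (↝-sound r) (⊑-refl {⟦ R ⟧ V})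
    ↝-sound (⊕ʳ {R = R} r) = ⊕ᶜ-mono (⊑-refl {⟦ R ⟧ V}) (↝-sound r)

    ⟶-sound : ∀ {P Q} → P ⟶ Q → ⟦ Q ⟧ V ⊑ ⟦ P ⟧ V
    ⟶-sound (_ , _ , P≈P' , P'↝Q' , Q'≈Q) =
      ⊑-trans (proj₂ (≈-sound Q'≈Q)) (⊑-trans (↝-sound P'↝Q') (proj₂ (≈-sound P≈P')))

    ⟶*-sound : ∀ {P Q} → P ⟶* Q → ⟦ Q ⟧ V ⊑ ⟦ P ⟧ V
    ⟶*-sound (done P≈Q)     = proj₂ (≈-sound P≈Q)
    ⟶*-sound (step P⟶Q Q⟶*R) = ⊑-trans (⟶*-sound Q⟶*R) (⟶-sound P⟶Q)

theorem3p49 : {A : Set} (P : Str A) → P ⟶* 𝟏 →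
    (F : MAVFrame) (V : A → Chu.ChuElem F) →
    Chu._⊑_ F (Chu.Iᶜ F) (Chu.⟦_⟧ F P V)
theorem3p49 P P⟶*𝟏 F V = Soundness.Interpretation.⟶*-sound F V P⟶*𝟏
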